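{- For any two distinct jobs $i,j$ and any time $t\ge0$: $i\prec_{l(t)}j$ if and only if $\varphi_i(t)>\varphi_j(t)$, where $\varphi_k(t)=\frac{w_k}{p_k(p_k+t)}$.
   Context: Each job $k$ has processing time $p_k>0$ and weight $w_k>0$. In a schedule jobs are processed consecutively without idle time; $C_k$ is the completion time of job $k$, and the cost of a schedule is $\sum_k -w_k/C_k$ (to be minimized). Local dominance: $i\prec_{l(t)}j$ means that in a schedule in which job $j$ starts at time $t$ and is immediately followed by job $i$, exchanging the positions of $i$ and $j$ (so that $i$ starts at $t$ and $j$ directly follows) strictly decreases the cost.
   Formalization: The processing times $p_k$, the weights $w_k$ and the time $t$ are rational numbers. -}

module Defs where

open import Data.Nat using (ℕ)
open import Data.Fin using (Fin)
open import Data.List using (List; []; _∷_)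
open import Data.Rational using (ℚ; 0ℚ; _+_; _*_; -_; 1/_; _≟_; _<_; ≢-nonZero)
open import Relation.Nullary using (yes; no)

-- Total reciprocal on ℚ (value 0 at 0).  It is only ever applied to
-- strictly positive quantities (completion times, p_k (p_k + t)), where it
-- coincides with the usual reciprocal 1/q.
recip : ℚ → ℚ
recip q with q ≟ 0ℚ
... | yes _   = 0ℚ
... | no q≢0 = 1/_ q {{≢-nonZero q≢0}}

costFrom : {n : ℕ} → (p w : Fin n → ℚ) → ℚ → List (Fin n) → ℚ
costFrom p w t []       = 0ℚ
costFrom p w t (k ∷ ks) = (- (w k * recip (t + p k))) + costFrom p w (t + p k) ks

-- i ≺_{l(t)} j : in a schedule where j starts at t and is immediately
-- followed by i, swapping i and j strictly decreases the cost.  The jobs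
-- before t are unaffected by the swap (same completion times), so only the
-- part of the schedule from time t on is compared; the remainder B of the
-- schedule after the pair is arbitrary.
localDom : {n : ℕ} → (p w : Fin n → ℚ) → ℚ → Fin n → Fin n → Set
localDom {n} p w t i j =
  (B : List (Fin n)) → costFrom p w t (i ∷ j ∷ B) < costFrom p w t (j ∷ i ∷ B)

φ : {n : ℕ} → (p w : Fin n → ℚ) → Fin n → ℚ → ℚ
φ p w k t = w k * recip (p k * (p k + t))

-- With T = t + p_i + p_j the completion time of the pair, the identity
-- 1/(t + p_i) - 1/T = p_j / ((t + p_i) T) shows that
--   cost(i j B) + (p_i p_j / T) φ_i(t) = -(w_i + w_j)/T + cost_T(B),
-- which is symmetric in i and j.  Hence
--   cost(j i B) - cost(i j B) = (p_i p_j / T) (φ_i(t) - φ_j(t))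
-- with a positive factor, whatever the rest B of the schedule.
module Submission where

open import Defs
open import Data.Nat using (ℕ)
open import Data.Fin using (Fin)
open import Data.Rational using (ℚ; 0ℚ; _<_; _≤_)
open import Data.Product using (_×_)
open import Function.Bundles using (_⇔_)
open import Relation.Binary.PropositionalEquality using (_≢_)

open import Data.List using ([]; _∷_)
open import Data.Rational using (1ℚ; _+_; _*_; -_; _-_; _≟_; _<?_; ≢-nonZero; positive)
open import Data.Rational.Properties
  using ( +-*-commutativeRing; *-inverseʳ; 1/pos⇒pos; positive⁻¹; pos*pos⇒pos; pos⇒nonNeg
        ; <⇒≢; <⇒≤; ≮⇒≥; +-mono-<-≤; +-mono-≤-<; *-monoʳ-<-pos; *-cancelˡ-<-nonNeg
        ; *-zeroʳ; +-comm; *-comm; +-0-commutativeMonoid)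
open import Algebra.Bundles using (module CommutativeMonoid)
open import Algebra.Properties.CommutativeSemigroup (CommutativeMonoid.commutativeSemigroup +-0-commutativeMonoid)
  using (xy∙z≈xz∙y)
open import Data.Empty using (⊥-elim)
open import Function.Bundles using (mk⇔; module Equivalence)
import Function.Properties.Equivalence as ⇔
open import Level using (0ℓ)
open import Relation.Binary.PropositionalEquality using (_≡_; refl; sym; trans; cong; module ≡-Reasoning)
open import Relation.Nullary using (yes; no)
open import Relation.Nullary.Decidable using (decidable-stable; dec⇒maybe)
import Tactic.RingSolver.Core.AlmostCommutativeRing as ACR
open import Tactic.RingSolver using (solve)

ℚ-ring : ACR.AlmostCommutativeRing 0ℓ 0ℓ
ℚ-ring = ACR.fromCommutativeRing +-*-commutativeRing (λ q → dec⇒maybe (0ℚ ≟ q))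

x+a≡y+b⇒x<y⇔b<a : ∀ {x y a b} → x + a ≡ y + b → (x < y) ⇔ (b < a)
x+a≡y+b⇒x<y⇔b<a {x} {y} {a} {b} eq = mk⇔ to from
  where
  to : x < y → b < a
  to x<y = decidable-stable (b <? a) λ b≮a → <⇒≢ (+-mono-<-≤ x<y (≮⇒≥ b≮a)) eq
  from : b < a → x < y
  from b<a = decidable-stable (x <? y) λ x≮y → <⇒≢ (+-mono-≤-< (≮⇒≥ x≮y) b<a) (sym eq)

*-cancelˡ-<⇔-pos : ∀ {c x y} → 0ℚ < c → (c * x < c * y) ⇔ (x < y)
*-cancelˡ-<⇔-pos {c} 0<c =
  mk⇔ (*-cancelˡ-<-nonNeg c {{pos⇒nonNeg c {{positive 0<c}}}}) (*-monoʳ-<-pos c {{positive 0<c}})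

0<* : ∀ {x y} → 0ℚ < x → 0ℚ < y → 0ℚ < x * y
0<* {x} {y} 0<x 0<y = positive⁻¹ (x * y) {{pos*pos⇒pos x {{positive 0<x}} y {{positive 0<y}}}}

0<⇒≢0 : ∀ {x} → 0ℚ < x → x ≢ 0ℚ
0<⇒≢0 0<x x≡0 = <⇒≢ 0<x (sym x≡0)

recip-inverseʳ : ∀ {q} → q ≢ 0ℚ → q * recip q ≡ 1ℚ
recip-inverseʳ {q} q≢0 with q ≟ 0ℚ
... | yes q≡0 = ⊥-elim (q≢0 q≡0)
... | no q≢0′ = *-inverseʳ q {{≢-nonZero q≢0′}}

recip-pos : ∀ {q} → 0ℚ < q → 0ℚ < recip q
recip-pos {q} 0<q with q ≟ 0ℚ
... | yes q≡0 = ⊥-elim (0<⇒≢0 0<q q≡0)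
... | no q≢0 = positive⁻¹ _ {{1/pos⇒pos q {{positive 0<q}}}}

module _ (x y u v : ℚ) where
  open ≡-Reasoning

  inverse-cancelˡ : x * y * u ≡ 1ℚ → y * v ≡ 1ℚ → x * u ≡ v
  inverse-cancelˡ xyu≡1 yv≡1 = begin
    x * u             ≡⟨ solve (x ∷ u ∷ []) ℚ-ring ⟩
    x * u * 1ℚ        ≡⟨ cong (x * u *_) (sym yv≡1) ⟩
    x * u * (y * v)   ≡⟨ solve (x ∷ y ∷ u ∷ v ∷ []) ℚ-ring ⟩
    x * y * u * v     ≡⟨ cong (_* v) xyu≡1 ⟩
    1ℚ * v            ≡⟨ solve (v ∷ []) ℚ-ring ⟩
    v                 ∎

  inverse-sub : x * u ≡ 1ℚ → (x + y) * v ≡ 1ℚ → u - v ≡ u * v * y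
  inverse-sub xu≡1 [x+y]v≡1 = begin
    u - v                          ≡⟨ solve (u ∷ v ∷ []) ℚ-ring ⟩
    u * 1ℚ - v * 1ℚ                ≡⟨ cong (λ e → u * e - v * 1ℚ) (sym [x+y]v≡1) ⟩
    u * ((x + y) * v) - v * 1ℚ     ≡⟨ cong (λ e → u * ((x + y) * v) - v * e) (sym xu≡1) ⟩
    u * ((x + y) * v) - v * (x * u) ≡⟨ solve (x ∷ y ∷ u ∷ v ∷ []) ℚ-ring ⟩
    u * v * y                      ∎

recip-*-cancelˡ : ∀ x y → x * y ≢ 0ℚ → x * recip (x * y) ≡ recip y
recip-*-cancelˡ x y xy≢0 = inverse-cancelˡ x y (recip (x * y)) (recip y) (recip-inverseʳ xy≢0) (recip-inverseʳ y≢0)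
  where
  y≢0 : y ≢ 0ℚ
  y≢0 y≡0 = xy≢0 (trans (cong (x *_) y≡0) (*-zeroʳ x))

recip-sub : ∀ x y → x ≢ 0ℚ → x + y ≢ 0ℚ → recip x - recip (x + y) ≡ recip x * recip (x + y) * y
recip-sub x y x≢0 x+y≢0 = inverse-sub x y (recip x) (recip (x + y)) (recip-inverseʳ x≢0) (recip-inverseʳ x+y≢0)

-- rC and rT stand for 1/(t + p_k) and 1/T, rφ for 1/(p_k (p_k + t)), R for the cost after T.
two-job-balance : ∀ wk wl pk pl rφ rC rT R → pk * rφ ≡ rC → rC - rT ≡ rC * rT * pl
  → (- (wk * rC)) + ((- (wl * rT)) + R) + pk * pl * rT * (wk * rφ) ≡ (- ((wk + wl) * rT)) + R
two-job-balance wk wl pk pl rφ rC rT R pk*rφ≡rC rC-rT≡rC*rT*pl = begin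
  (- (wk * rC)) + ((- (wl * rT)) + R) + pk * pl * rT * (wk * rφ)
    ≡⟨ solve (wk ∷ wl ∷ pk ∷ pl ∷ rφ ∷ rC ∷ rT ∷ R ∷ []) ℚ-ring ⟩
  (- (wk * rC)) + ((- (wl * rT)) + R) + wk * pl * rT * (pk * rφ)
    ≡⟨ cong (λ e → (- (wk * rC)) + ((- (wl * rT)) + R) + wk * pl * rT * e) pk*rφ≡rC ⟩
  (- (wk * rC)) + ((- (wl * rT)) + R) + wk * pl * rT * rC
    ≡⟨ solve (wk ∷ wl ∷ pl ∷ rC ∷ rT ∷ R ∷ []) ℚ-ring ⟩
  (- (wk * rC)) + ((- (wl * rT)) + R) + wk * (rC * rT * pl)
    ≡⟨ cong (λ e → (- (wk * rC)) + ((- (wl * rT)) + R) + wk * e) rC-rT≡rC*rT*pl ⟨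
  (- (wk * rC)) + ((- (wl * rT)) + R) + wk * (rC - rT)
    ≡⟨ solve (wk ∷ wl ∷ rC ∷ rT ∷ R ∷ []) ℚ-ring ⟩
  (- ((wk + wl) * rT)) + R ∎
  where open ≡-Reasoning

module _ {n : ℕ} (p w : Fin n → ℚ) (0<p : ∀ k → 0ℚ < p k) {t : ℚ} (0≤t : 0ℚ ≤ t) where

  pair-cost : ∀ k l B {T} → t + p k + p l ≡ T
    → costFrom p w t (k ∷ l ∷ B) + p k * p l * recip T * φ p w k t
      ≡ (- ((w k + w l) * recip T)) + costFrom p w T B
  pair-cost k l B refl =
    two-job-balance (w k) (w l) (p k) (p l) (recip (p k * (p k + t))) (recip (t + p k)) (recip (t + p k + p l))
      (costFrom p w (t + p k + p l) B)
      pk*rφ≡rC (recip-sub (t + p k) (p l) (0<⇒≢0 0<t+pk) (0<⇒≢0 0<t+pk+pl))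
    where
    0<t+pk : 0ℚ < t + p k
    0<t+pk = +-mono-≤-< 0≤t (0<p k)
    0<t+pk+pl : 0ℚ < t + p k + p l
    0<t+pk+pl = +-mono-<-≤ 0<t+pk (<⇒≤ (0<p l))
    pk*rφ≡rC : p k * recip (p k * (p k + t)) ≡ recip (t + p k)
    pk*rφ≡rC = trans
      (recip-*-cancelˡ (p k) (p k + t) (0<⇒≢0 (0<* (0<p k) (+-mono-<-≤ (0<p k) 0≤t))))
      (cong recip (+-comm (p k) t))

  exchange-balance : ∀ i j B →
    let c = p i * p j * recip (t + p i + p j) in
    costFrom p w t (i ∷ j ∷ B) + c * φ p w i t ≡ costFrom p w t (j ∷ i ∷ B) + c * φ p w j t
  exchange-balance i j B = begin
    costFrom p w t (i ∷ j ∷ B) + p i * p j * recip T * φ p w i t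
      ≡⟨ pair-cost i j B refl ⟩
    (- ((w i + w j) * recip T)) + costFrom p w T B
      ≡⟨ cong (λ e → (- (e * recip T)) + costFrom p w T B) (+-comm (w i) (w j)) ⟩
    (- ((w j + w i) * recip T)) + costFrom p w T B
      ≡⟨ pair-cost j i B (xy∙z≈xz∙y t (p j) (p i)) ⟨
    costFrom p w t (j ∷ i ∷ B) + p j * p i * recip T * φ p w j t
      ≡⟨ cong (λ e → costFrom p w t (j ∷ i ∷ B) + e * recip T * φ p w j t) (*-comm (p j) (p i)) ⟩
    costFrom p w t (j ∷ i ∷ B) + p i * p j * recip T * φ p w j t ∎
    where
    open ≡-Reasoning
    T : ℚ
    T = t + p i + p j

  swap-improves⇔ : ∀ i j B → costFrom p w t (i ∷ j ∷ B) < costFrom p w t (j ∷ i ∷ B) ⇔ φ p w j t < φ p w i t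
  swap-improves⇔ i j B = ⇔.trans (x+a≡y+b⇒x<y⇔b<a (exchange-balance i j B)) (*-cancelˡ-<⇔-pos 0<c)
    where
    0<c : 0ℚ < p i * p j * recip (t + p i + p j)
    0<c = 0<* (0<* (0<p i) (0<p j)) (recip-pos (+-mono-<-≤ (+-mono-≤-< 0≤t (0<p i)) (<⇒≤ (0<p j))))

lemma1 : (n : ℕ) (p w : Fin n → ℚ)
         → ((k : Fin n) → 0ℚ < p k) → ((k : Fin n) → 0ℚ < w k)
         → (i j : Fin n) → i ≢ j → (t : ℚ) → 0ℚ ≤ t
         → localDom p w t i j ⇔ (φ p w j t < φ p w i t)
lemma1 n p w 0<p _ i j _ t 0≤t = mk⇔ (λ i≺j → to (improves []) (i≺j [])) (λ φj<φi B → from (improves B) φj<φi)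
  where
  open Equivalence
  improves : ∀ B → costFrom p w t (i ∷ j ∷ B) < costFrom p w t (j ∷ i ∷ B) ⇔ φ p w j t < φ p w i t
  improves = swap-improves⇔ p w 0<p 0≤t i j
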